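{- Let $B$ be a real skew-symmetric $n\times n$ matrix with all entries in $[-1,1]$, let $J_n$ be the $n\times n$ all-ones matrix, and let $j\in\mathbb{R}^n$ be the all-ones vector. Then \[\operatorname{Tr}(J_n+B)^4=\operatorname{Tr}J_n^4+\operatorname{Tr}B^4-4n\|Bj\|^2\quad\text{and}\quad\operatorname{Tr}(J_n+B)^8\le\operatorname{Tr}J_n^8+\operatorname{Tr}B^8-2n^5\|Bj\|^2.\] In particular, $\operatorname{Tr}(J_n+B)^4\le\operatorname{Tr}J_n^4+\operatorname{Tr}B^4$ and $\operatorname{Tr}(J_n+B)^8\le\operatorname{Tr}J_n^8+\operatorname{Tr}B^8$, and (in each of these two inequalities) equality holds if and only if every row of $B$ sums to zero. -}

module Defs where

open import Level using (Level; _⊔_; suc)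
open import Data.Nat using (ℕ; zero) renaming (suc to sucℕ)
open import Data.Fin using (Fin)
open import Data.Product using (Σ; ∃; _×_; _,_)
open import Relation.Nullary using (¬_)
open import Relation.Binary.Structures using (IsTotalOrder)
open import Algebra.Bundles using (CommutativeRing)

-- The real numbers, axiomatised as a complete ordered field
-- (a Dedekind-complete ordered field; unique up to isomorphism).

record RealField c ℓ₁ ℓ₂ : Set (suc (c ⊔ ℓ₁ ⊔ ℓ₂)) where
  field
    commutativeRing : CommutativeRing c ℓ₁
  open CommutativeRing commutativeRing public
  field
    _≤_          : Carrier → Carrier → Set ℓ₂
    isTotalOrder : IsTotalOrder _≈_ _≤_
    0≉1          : ¬ (0# ≈ 1#)
    +-monoʳ-≤    : ∀ {x y} z → x ≤ y → (x + z) ≤ (y + z)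
    *-nonneg     : ∀ {x y} → 0# ≤ x → 0# ≤ y → 0# ≤ (x * y)
    inverse      : ∀ x → ¬ (x ≈ 0#) → Σ Carrier (λ y → (x * y) ≈ 1#)
    lub          : (P : Carrier → Set c) →
                   Σ Carrier P →
                   Σ Carrier (λ b → ∀ x → P x → x ≤ b) →
                   Σ Carrier (λ s → (∀ x → P x → x ≤ s) ×
                                    (∀ b → (∀ x → P x → x ≤ b) → s ≤ b))

module Matrices {c ℓ₁ ℓ₂} (R : RealField c ℓ₁ ℓ₂) where
  open RealField R

  ∑ : ∀ {n} → (Fin n → Carrier) → Carrier
  ∑ {zero}   f = 0#
  ∑ {sucℕ n} f = f Fin.zero + ∑ (λ i → f (Fin.suc i))
    where import Data.Fin as Fin

  fromℕ : ℕ → Carrier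
  fromℕ zero     = 0#
  fromℕ (sucℕ n) = 1# + fromℕ n

  Matrix : ℕ → Set c
  Matrix n = Fin n → Fin n → Carrier

  Vector : ℕ → Set c
  Vector n = Fin n → Carrier

  _⊕_ : ∀ {n} → Matrix n → Matrix n → Matrix n
  (A ⊕ B) i j = A i j + B i j

  _⊗_ : ∀ {n} → Matrix n → Matrix n → Matrix n
  (A ⊗ B) i j = ∑ (λ k → A i k * B k j)

  identity : ∀ {n} → Matrix n
  identity i j with i Data.Fin.≟ j
    where import Data.Fin
  ... | Relation.Nullary.yes _ = 1#
    where import Relation.Nullary
  ... | Relation.Nullary.no _ = 0#
    where import Relation.Nullary

  _^_ : ∀ {n} → Matrix n → ℕ → Matrix n
  M ^ zero     = identity
  M ^ (sucℕ k) = M ⊗ (M ^ k)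

  Tr : ∀ {n} → Matrix n → Carrier
  Tr M = ∑ (λ i → M i i)

  J : ∀ n → Matrix n
  J n i j = 1#

  ones : ∀ n → Vector n
  ones n i = 1#

  _·_ : ∀ {n} → Matrix n → Vector n → Vector n
  (M · v) i = ∑ (λ k → M i k * v k)

  ‖_‖² : ∀ {n} → Vector n → Carrier
  ‖ v ‖² = ∑ (λ i → v i * v i)

  SkewSymmetric : ∀ {n} → Matrix n → Set ℓ₁
  SkewSymmetric B = ∀ i j → B i j ≈ - B j i

  EntriesIn[-1,1] : ∀ {n} → Matrix n → Set ℓ₂
  EntriesIn[-1,1] B = ∀ i j → ((- 1#) ≤ B i j) × (B i j ≤ 1#)

  RowSumsZero : ∀ {n} → Matrix n → Set ℓ₁
  RowSumsZero B = ∀ i → ∑ (λ j → B i j) ≈ 0#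

module Submission where

-- Lemma 17.  B real skew-symmetric n×n with entries in [-1,1], J = jjᵀ the
-- all-ones matrix, M = J + B, x_p = Bᵖj the Krylov vectors, σ(v) = jᵀv.
-- Since M v = σ(v) j + B v, powers of M map combinations of the x_p to
-- combinations whose coefficients are polynomials in the moments σ(x_p), and
-- peeling one factor gives Tr(B^q M^{a+1}) = σ(Mᵃ x_q) + Tr(B^{q+1} Mᵃ); hence
-- Tr Mᵏ = E_k + Tr Bᵏ for an explicitly computed polynomial E_k.  For skew B,
-- σ(x_{2m+1}) = 0 and σ(x_{2m}) = (−1)ᵐ‖x_m‖², so the ring solver evaluates E_4
-- and E_8 in n, s = ‖Bj‖², t = ‖B²j‖², u = ‖B³j‖².  The 8th-power bound is
--   (Tr J⁸ + Tr B⁸ − 2n⁵s) − Tr M⁸ = 2n‖n²x₁ + 2x₃‖² + 4n²s(n³ − 3s) + 8st ≥ 0,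
-- using the cyclic triple-sum bound 3s ≤ n³; equality forces s = 0, i.e. Bj = 0.
-- Order of the file: the map ℤ → R making the ring solver available; finite
-- sums and ordered-field facts (including "x² ≤ 0 ⇒ x = 0" via completeness);
-- matrix algebra; the rank-one expansion; the skew-symmetric moments and the
-- trace formulas; the bound 3s ≤ n³; and finally lemma17.

open import Defs
open import Algebra.Bundles using (CommutativeRing; Semiring)
import Algebra.Solver.Ring.AlmostCommutativeRing as ACR
open import Level using (_⊔_)
open import Data.Nat as ℕ using (ℕ; zero; suc)
import Data.Nat.Properties as ℕP
open import Data.Integer as ℤ using (ℤ; +_; -[1+_])
import Data.Integer.Properties as ℤP
open import Data.Integer.Tactic.RingSolver using (solve-∀)
open import Data.Fin using (Fin; _≟_) renaming (zero to fzero; suc to fsuc)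
open import Data.Vec using (Vec; []; _∷_)
open import Data.Maybe using (Maybe; just; nothing)
open import Data.Product using (Σ; ∃₂; _×_; _,_; proj₁; proj₂)
open import Data.Sum using (inj₁; inj₂)
open import Data.Empty using (⊥-elim)
open import Function using (_∘_)
open import Function.Bundles using (_⇔_; mk⇔)
open import Relation.Nullary using (yes; no)
open import Relation.Binary.Structures using (IsTotalOrder)
import Relation.Binary.PropositionalEquality as ≡
open ≡ using (_≡_)

module IntegerCoefficients {c ℓ} (CR : CommutativeRing c ℓ) where
  open CommutativeRing CR
  open import Algebra.Properties.Ring ring
    using (-‿+-comm; -0#≈0#; -‿distribˡ-*; ⁻¹-anti-homo‿-; x[y-z]≈xy-xz)
  open import Algebra.Properties.Semiring.Mult.TCOptimised semiring
    using (1+×; ×-homo-+; ×1-homo-*) renaming (_×_ to _×ᴿ_)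
  open import Algebra.Properties.CommutativeSemigroup +-commutativeSemigroup
    using (interchange)
  open import Relation.Binary.Reasoning.Setoid setoid

  ⟦_⟧ℤ : ℤ → Carrier
  ⟦ + n ⟧ℤ      = n ×ᴿ 1#
  ⟦ -[1+ n ] ⟧ℤ = - (suc n ×ᴿ 1#)

  ⟦⟧ℤ-cong : ∀ {i j} → i ≡ j → ⟦ i ⟧ℤ ≈ ⟦ j ⟧ℤ
  ⟦⟧ℤ-cong e = reflexive (≡.cong ⟦_⟧ℤ e)

  -- Ring identities for formal differences a − b; they transport the integer
  -- operations, every integer being a difference of two naturals.
  common-summand : ∀ x y z → (x + y) - (x + z) ≈ y - z
  common-summand x y z = begin
    (x + y) + - (x + z)    ≈⟨ +-congˡ (-‿+-comm x z) ⟨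
    (x + y) + (- x + - z)  ≈⟨ interchange x y (- x) (- z) ⟩
    (x + - x) + (y + - z)  ≈⟨ +-congʳ (-‿inverseʳ x) ⟩
    0# + (y - z)           ≈⟨ +-identityˡ (y - z) ⟩
    y - z                  ∎

  difference-+ : ∀ a b c d → (a - b) + (c - d) ≈ (a + c) - (b + d)
  difference-+ a b c d = begin
    (a + - b) + (c + - d)  ≈⟨ interchange a (- b) c (- d) ⟩
    (a + c) + (- b + - d)  ≈⟨ +-congˡ (-‿+-comm b d) ⟩
    (a + c) + - (b + d)    ∎

  difference-* : ∀ a b c d → (a - b) * (c - d) ≈ (a * c + b * d) - (a * d + b * c)
  difference-* a b c d = begin
    (a - b) * (c - d)                  ≈⟨ distribʳ (c - d) a (- b) ⟩
    a * (c - d) + - b * (c - d)        ≈⟨ +-cong (x[y-z]≈xy-xz a c d) negated ⟩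
    (a * c - a * d) + (b * d - b * c)  ≈⟨ difference-+ (a * c) (a * d) (b * d) (b * c) ⟩
    (a * c + b * d) - (a * d + b * c)  ∎
    where
    negated : - b * (c - d) ≈ b * d - b * c
    negated = trans (sym (-‿distribˡ-* b (c - d)))
                    (trans (-‿cong (x[y-z]≈xy-xz b c d)) (⁻¹-anti-homo‿- (b * c) (b * d)))

  ⊖-homo : ∀ a b → ⟦ a ℤ.⊖ b ⟧ℤ ≈ a ×ᴿ 1# - b ×ᴿ 1#
  ⊖-homo a       zero    = sym (trans (+-congˡ -0#≈0#) (+-identityʳ (a ×ᴿ 1#)))
  ⊖-homo zero    (suc b) = sym (+-identityˡ _)
  ⊖-homo (suc a) (suc b) = begin
    ⟦ suc a ℤ.⊖ suc b ⟧ℤ             ≈⟨ ⟦⟧ℤ-cong (ℤP.[1+m]⊖[1+n]≡m⊖n a b) ⟩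
    ⟦ a ℤ.⊖ b ⟧ℤ                     ≈⟨ ⊖-homo a b ⟩
    a ×ᴿ 1# - b ×ᴿ 1#                ≈⟨ common-summand 1# (a ×ᴿ 1#) (b ×ᴿ 1#) ⟨
    (1# + a ×ᴿ 1#) - (1# + b ×ᴿ 1#)  ≈⟨ +-cong (1+× a 1#) (-‿cong (1+× b 1#)) ⟨
    suc a ×ᴿ 1# - suc b ×ᴿ 1#        ∎

  asDifference : ∀ i → ∃₂ λ a b → i ≡ + a ℤ.- + b
  asDifference (+ n)    = n , 0 , ≡.sym (ℤP.+-identityʳ (+ n))
  asDifference -[1+ n ] = 0 , suc n , ≡.refl

  difference-homo : ∀ a b → ⟦ + a ℤ.- + b ⟧ℤ ≈ a ×ᴿ 1# - b ×ᴿ 1#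
  difference-homo a b = trans (⟦⟧ℤ-cong (ℤP.m-n≡m⊖n a b)) (⊖-homo a b)

  ℤ-difference-+ : ∀ a b c d →
    (+ a ℤ.- + b) ℤ.+ (+ c ℤ.- + d) ≡ + (a ℕ.+ c) ℤ.- + (b ℕ.+ d)
  ℤ-difference-+ a b c d = ≡.trans (identity (+ a) (+ b) (+ c) (+ d))
                                   (≡.sym (≡.cong₂ ℤ._-_ (ℤP.pos-+ a c) (ℤP.pos-+ b d)))
    where
    identity : ∀ (a b c d : ℤ) → (a ℤ.- b) ℤ.+ (c ℤ.- d) ≡ (a ℤ.+ c) ℤ.- (b ℤ.+ d)
    identity = solve-∀

  ℤ-difference-* : ∀ a b c d →
    (+ a ℤ.- + b) ℤ.* (+ c ℤ.- + d) ≡ + (a ℕ.* c ℕ.+ b ℕ.* d) ℤ.- + (a ℕ.* d ℕ.+ b ℕ.* c)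
  ℤ-difference-* a b c d = ≡.trans (identity (+ a) (+ b) (+ c) (+ d))
                                   (≡.sym (≡.cong₂ ℤ._-_ (products a c b d) (products a d b c)))
    where
    identity : ∀ (a b c d : ℤ) →
      (a ℤ.- b) ℤ.* (c ℤ.- d) ≡ (a ℤ.* c ℤ.+ b ℤ.* d) ℤ.- (a ℤ.* d ℤ.+ b ℤ.* c)
    identity = solve-∀
    products : ∀ a b c d → + (a ℕ.* b ℕ.+ c ℕ.* d) ≡ + a ℤ.* + b ℤ.+ + c ℤ.* + d
    products a b c d = ≡.trans (ℤP.pos-+ (a ℕ.* b) (c ℕ.* d))
                               (≡.cong₂ ℤ._+_ (ℤP.pos-* a b) (ℤP.pos-* c d))

  ℤ-difference-neg : ∀ a b → ℤ.- (+ a ℤ.- + b) ≡ + b ℤ.- + a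
  ℤ-difference-neg a b = identity (+ a) (+ b)
    where
    identity : ∀ (a b : ℤ) → ℤ.- (a ℤ.- b) ≡ b ℤ.- a
    identity = solve-∀

  +-homo : ∀ i j → ⟦ i ℤ.+ j ⟧ℤ ≈ ⟦ i ⟧ℤ + ⟦ j ⟧ℤ
  +-homo i j with asDifference i | asDifference j
  ... | a , b , ≡.refl | c , d , ≡.refl = begin
    ⟦ (+ a ℤ.- + b) ℤ.+ (+ c ℤ.- + d) ⟧ℤ
      ≈⟨ ⟦⟧ℤ-cong (ℤ-difference-+ a b c d) ⟩
    ⟦ + (a ℕ.+ c) ℤ.- + (b ℕ.+ d) ⟧ℤ
      ≈⟨ difference-homo (a ℕ.+ c) (b ℕ.+ d) ⟩
    (a ℕ.+ c) ×ᴿ 1# - (b ℕ.+ d) ×ᴿ 1#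
      ≈⟨ +-cong (×-homo-+ 1# a c) (-‿cong (×-homo-+ 1# b d)) ⟩
    (a ×ᴿ 1# + c ×ᴿ 1#) - (b ×ᴿ 1# + d ×ᴿ 1#)
      ≈⟨ difference-+ _ _ _ _ ⟨
    (a ×ᴿ 1# - b ×ᴿ 1#) + (c ×ᴿ 1# - d ×ᴿ 1#)
      ≈⟨ +-cong (difference-homo a b) (difference-homo c d) ⟨
    ⟦ + a ℤ.- + b ⟧ℤ + ⟦ + c ℤ.- + d ⟧ℤ ∎

  *-homo : ∀ i j → ⟦ i ℤ.* j ⟧ℤ ≈ ⟦ i ⟧ℤ * ⟦ j ⟧ℤ
  *-homo i j with asDifference i | asDifference j
  ... | a , b , ≡.refl | c , d , ≡.refl = begin
    ⟦ (+ a ℤ.- + b) ℤ.* (+ c ℤ.- + d) ⟧ℤ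
      ≈⟨ ⟦⟧ℤ-cong (ℤ-difference-* a b c d) ⟩
    ⟦ + (a ℕ.* c ℕ.+ b ℕ.* d) ℤ.- + (a ℕ.* d ℕ.+ b ℕ.* c) ⟧ℤ
      ≈⟨ difference-homo (a ℕ.* c ℕ.+ b ℕ.* d) (a ℕ.* d ℕ.+ b ℕ.* c) ⟩
    (a ℕ.* c ℕ.+ b ℕ.* d) ×ᴿ 1# - (a ℕ.* d ℕ.+ b ℕ.* c) ×ᴿ 1#
      ≈⟨ +-cong (products a c b d) (-‿cong (products a d b c)) ⟩
    (⟦a⟧ * ⟦c⟧ + ⟦b⟧ * ⟦d⟧) - (⟦a⟧ * ⟦d⟧ + ⟦b⟧ * ⟦c⟧)
      ≈⟨ difference-* ⟦a⟧ ⟦b⟧ ⟦c⟧ ⟦d⟧ ⟨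
    (⟦a⟧ - ⟦b⟧) * (⟦c⟧ - ⟦d⟧)
      ≈⟨ *-cong (difference-homo a b) (difference-homo c d) ⟨
    ⟦ + a ℤ.- + b ⟧ℤ * ⟦ + c ℤ.- + d ⟧ℤ ∎
    where
    ⟦a⟧ ⟦b⟧ ⟦c⟧ ⟦d⟧ : Carrier
    ⟦a⟧ = a ×ᴿ 1#
    ⟦b⟧ = b ×ᴿ 1#
    ⟦c⟧ = c ×ᴿ 1#
    ⟦d⟧ = d ×ᴿ 1#
    products : ∀ p q r s → (p ℕ.* q ℕ.+ r ℕ.* s) ×ᴿ 1# ≈ (p ×ᴿ 1#) * (q ×ᴿ 1#) + (r ×ᴿ 1#) * (s ×ᴿ 1#)
    products p q r s = trans (×-homo-+ 1# (p ℕ.* q) (r ℕ.* s)) (+-cong (×1-homo-* p q) (×1-homo-* r s))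

  -‿homo : ∀ i → ⟦ ℤ.- i ⟧ℤ ≈ - ⟦ i ⟧ℤ
  -‿homo i with asDifference i
  ... | a , b , ≡.refl = begin
    ⟦ ℤ.- (+ a ℤ.- + b) ⟧ℤ  ≈⟨ ⟦⟧ℤ-cong (ℤ-difference-neg a b) ⟩
    ⟦ + b ℤ.- + a ⟧ℤ        ≈⟨ difference-homo b a ⟩
    b ×ᴿ 1# - a ×ᴿ 1#       ≈⟨ ⁻¹-anti-homo‿- (a ×ᴿ 1#) (b ×ᴿ 1#) ⟨
    - (a ×ᴿ 1# - b ×ᴿ 1#)   ≈⟨ -‿cong (difference-homo a b) ⟨
    - ⟦ + a ℤ.- + b ⟧ℤ      ∎

  ℤ-morphism : ℤ.+-*-rawRing ACR.-Raw-AlmostCommutative⟶ ACR.fromCommutativeRing CR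
  ℤ-morphism = record
    { ⟦_⟧ = ⟦_⟧ℤ ; +-homo = +-homo ; *-homo = *-homo ; -‿homo = -‿homo
    ; 0-homo = refl ; 1-homo = refl }

  coefficient≟ : ∀ i j → Maybe (⟦ i ⟧ℤ ≈ ⟦ j ⟧ℤ)
  coefficient≟ i j with i ℤ.≟ j
  ... | yes i≡j = just (⟦⟧ℤ-cong i≡j)
  ... | no _    = nothing

  open import Algebra.Solver.Ring ℤ.+-*-rawRing (ACR.fromCommutativeRing CR) ℤ-morphism coefficient≟
    public using (solve; prove; Polynomial; var; con; ⟦_⟧; _:+_; _:*_; _:-_; :-_; _:^_; _:=_)

module Theory {c ℓ₁ ℓ₂} (R : RealField c ℓ₁ ℓ₂) where
  open RealField R
  open Matrices R
  open IntegerCoefficients commutativeRing public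
  open import Algebra.Properties.Ring ring
    using (-‿involutive; -‿+-comm; -0#≈0#; -‿distribʳ-*)
  open import Algebra.Properties.Semiring.Mult.TCOptimised semiring using (1+×; ×1-homo-*)
  open import Algebra.Definitions.RawSemiring (Semiring.rawSemiring semiring) using () renaming (_^_ to _^ᴿ_)
  open import Algebra.Properties.CommutativeSemigroup +-commutativeSemigroup
    using (interchange)
  open import Algebra.Properties.CommutativeSemigroup *-commutativeSemigroup
    using () renaming (x∙yz≈y∙xz to x*yz≈y*xz)
  open import Relation.Binary.Reasoning.Setoid setoid
  module O = IsTotalOrder isTotalOrder

  K : ∀ {m} → ℤ → Polynomial m
  K z = con z

  fromℕ≈numeral : ∀ m → fromℕ m ≈ ⟦ + m ⟧ℤ
  fromℕ≈numeral zero    = refl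
  fromℕ≈numeral (suc m) = trans (+-congˡ (fromℕ≈numeral m)) (sym (1+× m 1#))

  fromℕ-* : ∀ a b → fromℕ (a ℕ.* b) ≈ fromℕ a * fromℕ b
  fromℕ-* a b = trans (fromℕ≈numeral (a ℕ.* b))
                      (trans (×1-homo-* a b) (sym (*-cong (fromℕ≈numeral a) (fromℕ≈numeral b))))

  fromℕ-^ : ∀ m k → fromℕ (m ℕ.^ k) ≈ fromℕ m ^ᴿ k
  fromℕ-^ m zero    = +-identityʳ 1#
  fromℕ-^ m (suc k) = trans (fromℕ-* m (m ℕ.^ k)) (*-congˡ (fromℕ-^ m k))

  ∑-cong : ∀ {m} {f g : Fin m → Carrier} → (∀ i → f i ≈ g i) → ∑ f ≈ ∑ g
  ∑-cong {zero}  f≈g = refl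
  ∑-cong {suc m} f≈g = +-cong (f≈g fzero) (∑-cong (f≈g ∘ fsuc))

  ∑-+ : ∀ {m} (f g : Fin m → Carrier) → ∑ (λ i → f i + g i) ≈ ∑ f + ∑ g
  ∑-+ {zero}  f g = sym (+-identityʳ 0#)
  ∑-+ {suc m} f g = trans (+-congˡ (∑-+ (f ∘ fsuc) (g ∘ fsuc))) (interchange _ _ _ _)

  ∑-*ˡ : ∀ {m} a (f : Fin m → Carrier) → ∑ (λ i → a * f i) ≈ a * ∑ f
  ∑-*ˡ {zero}  a f = sym (zeroʳ a)
  ∑-*ˡ {suc m} a f = trans (+-congˡ (∑-*ˡ a (f ∘ fsuc))) (sym (distribˡ _ _ _))

  ∑-*ʳ : ∀ {m} a (f : Fin m → Carrier) → ∑ (λ i → f i * a) ≈ ∑ f * a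
  ∑-*ʳ {zero}  a f = sym (zeroˡ a)
  ∑-*ʳ {suc m} a f = trans (+-congˡ (∑-*ʳ a (f ∘ fsuc))) (sym (distribʳ _ _ _))

  ∑-0 : ∀ m → ∑ {m} (λ _ → 0#) ≈ 0#
  ∑-0 zero    = refl
  ∑-0 (suc m) = trans (+-identityˡ _) (∑-0 m)

  ∑-neg : ∀ {m} (f : Fin m → Carrier) → ∑ (λ i → - f i) ≈ - ∑ f
  ∑-neg {zero}  f = sym -0#≈0#
  ∑-neg {suc m} f = trans (+-congˡ (∑-neg (f ∘ fsuc))) (-‿+-comm _ _)

  ∑-swap : ∀ {m k} (f : Fin m → Fin k → Carrier) →
           ∑ (λ i → ∑ (λ j → f i j)) ≈ ∑ (λ j → ∑ (λ i → f i j))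
  ∑-swap {zero}  {k} f = sym (∑-0 k)
  ∑-swap {suc m}     f = trans (+-congˡ (∑-swap (f ∘ fsuc)))
                               (sym (∑-+ (f fzero) (λ j → ∑ (λ i → f (fsuc i) j))))

  ∑-const : ∀ m a → ∑ {m} (λ _ → a) ≈ fromℕ m * a
  ∑-const zero    a = sym (zeroˡ a)
  ∑-const (suc m) a = trans (+-cong (sym (*-identityˡ a)) (∑-const m a)) (sym (distribʳ _ _ _))

  identity-suc : ∀ {m} (i k : Fin m) → identity (fsuc i) (fsuc k) ≡ identity i k
  identity-suc i k with i ≟ k
  ... | yes _ = ≡.refl
  ... | no _  = ≡.refl

  ∑-identityˡ : ∀ {m} (i : Fin m) (f : Fin m → Carrier) → ∑ (λ k → identity i k * f k) ≈ f i
  ∑-identityˡ {suc m} fzero    f =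
    trans (+-cong (*-identityˡ _) (trans (∑-cong {m} (λ k → zeroˡ _)) (∑-0 m))) (+-identityʳ _)
  ∑-identityˡ {suc m} (fsuc i) f =
    trans (+-cong (zeroˡ _) (trans (∑-cong (λ k → *-congʳ (reflexive (identity-suc i k))))
                                   (∑-identityˡ i (f ∘ fsuc))))
          (+-identityˡ _)

  ∑-identityʳ : ∀ {m} (l : Fin m) (f : Fin m → Carrier) → ∑ (λ k → f k * identity k l) ≈ f l
  ∑-identityʳ {suc m} fzero    f =
    trans (+-cong (*-identityʳ _) (trans (∑-cong {m} (λ k → zeroʳ _)) (∑-0 m))) (+-identityʳ _)
  ∑-identityʳ {suc m} (fsuc l) f =
    trans (+-cong (zeroʳ _) (trans (∑-cong (λ k → *-congˡ (reflexive (identity-suc k l))))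
                                   (∑-identityʳ l (f ∘ fsuc))))
          (+-identityˡ _)

  -- Ordered-field facts.  x ≤ y is the order x ≤ y of R, given the usual
  -- fixity so that terms like 0# ≤ x * x parse.
  infix 4 _≼_
  _≼_ : Carrier → Carrier → Set ℓ₂
  x ≼ y = x ≤ y

  ≤-≈ : ∀ {x y z} → x ≼ y → y ≈ z → x ≼ z
  ≤-≈ x≤y y≈z = O.≤-respʳ-≈ y≈z x≤y

  ≈-≤ : ∀ {x y z} → x ≈ y → y ≼ z → x ≼ z
  ≈-≤ x≈y y≤z = O.≤-respˡ-≈ (sym x≈y) y≤z

  +-monoˡ-≤ : ∀ {x y} z → x ≼ y → z + x ≼ z + y
  +-monoˡ-≤ {x} {y} z x≤y = ≈-≤ (+-comm z x) (≤-≈ (+-monoʳ-≤ z x≤y) (+-comm y z))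

  x≤y⇒0≤y-x : ∀ {x y} → x ≼ y → 0# ≼ y - x
  x≤y⇒0≤y-x {x} x≤y = ≈-≤ (sym (-‿inverseʳ x)) (+-monoʳ-≤ (- x) x≤y)

  0≤y-x⇒x≤y : ∀ {x y} → 0# ≼ y - x → x ≼ y
  0≤y-x⇒x≤y {x} {y} 0≤y-x = ≈-≤ (sym (+-identityˡ x)) (≤-≈ (+-monoʳ-≤ x 0≤y-x) y-x+x≈y)
    where
    y-x+x≈y : (y - x) + x ≈ y
    y-x+x≈y = trans (+-assoc y (- x) x) (trans (+-congˡ (-‿inverseˡ x)) (+-identityʳ y))

  x≤0⇒0≤-x : ∀ {x} → x ≼ 0# → 0# ≼ - x
  x≤0⇒0≤-x x≤0 = ≤-≈ (x≤y⇒0≤y-x x≤0) (+-identityˡ _)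

  0≤-x⇒x≤0 : ∀ {x} → 0# ≼ - x → x ≼ 0#
  0≤-x⇒x≤0 0≤-x = 0≤y-x⇒x≤y (≤-≈ 0≤-x (sym (+-identityˡ _)))

  +-nonneg : ∀ {x y} → 0# ≼ x → 0# ≼ y → 0# ≼ x + y
  +-nonneg {x} {y} 0≤x 0≤y = O.trans (≤-≈ 0≤y (sym (+-identityˡ y))) (+-monoʳ-≤ y 0≤x)

  *-nonneg-nonpos : ∀ {x y} → 0# ≼ x → y ≼ 0# → x * y ≼ 0#
  *-nonneg-nonpos {x} {y} 0≤x y≤0 =
    0≤-x⇒x≤0 (≤-≈ (*-nonneg 0≤x (x≤0⇒0≤-x y≤0)) (sym (-‿distribʳ-* x y)))

  x-d≤x : ∀ {x d} → 0# ≼ d → x - d ≼ x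
  x-d≤x {x} {d} 0≤d = 0≤y-x⇒x≤y (≤-≈ 0≤d (solve 2 (λ x d → d := x :- (x :- d)) refl x d))

  square-nonneg : ∀ x → 0# ≼ x * x
  square-nonneg x with O.total 0# x
  ... | inj₁ 0≤x = *-nonneg 0≤x 0≤x
  ... | inj₂ x≤0 = ≤-≈ (*-nonneg (x≤0⇒0≤-x x≤0) (x≤0⇒0≤-x x≤0))
                       (solve 1 (λ x → :- x :* :- x := x :* x) refl x)

  square-mono : ∀ {x y} → 0# ≼ x → x ≼ y → x * x ≼ y * y
  square-mono {x} {y} 0≤x x≤y = 0≤y-x⇒x≤y (≤-≈ (*-nonneg (x≤y⇒0≤y-x x≤y) (+-nonneg (O.trans 0≤x x≤y) 0≤x))
    (solve 2 (λ x y → (y :- x) :* (y :+ x) := y :* y :- x :* x) refl x y))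

  0≤1 : 0# ≼ 1#
  0≤1 = ≤-≈ (square-nonneg 1#) (*-identityˡ 1#)

  0≤fromℕ : ∀ m → 0# ≼ fromℕ m
  0≤fromℕ zero    = O.refl
  0≤fromℕ (suc m) = +-nonneg 0≤1 (0≤fromℕ m)

  1≤fromℕ : ∀ m → 1 ℕ.≤ m → 1# ≼ fromℕ m
  1≤fromℕ (suc m) _ = ≈-≤ (sym (+-identityʳ 1#)) (+-monoˡ-≤ 1# (0≤fromℕ m))

  double-nonneg : ∀ {x} → 0# ≼ x + x → 0# ≼ x
  double-nonneg {x} 0≤2x with O.total 0# x
  ... | inj₁ 0≤x = 0≤x
  ... | inj₂ x≤0 = O.trans 0≤2x (≤-≈ (+-monoʳ-≤ x x≤0) (+-identityˡ x))

  x≈-x⇒x≈0 : ∀ {x} → x ≈ - x → x ≈ 0#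
  x≈-x⇒x≈0 {x} x≈-x = O.antisym (0≤-x⇒x≤0 (double-nonneg (O.reflexive (sym -x-x≈0))))
                                (double-nonneg (O.reflexive (sym x+x≈0)))
    where
    x+x≈0 : x + x ≈ 0#
    x+x≈0 = trans (+-congˡ x≈-x) (-‿inverseʳ x)
    -x-x≈0 : - x + - x ≈ 0#
    -x-x≈0 = trans (+-congʳ (sym x≈-x)) (-‿inverseʳ x)

  ≤-scale : ∀ {s k} → 0# ≼ s → 1# ≼ k → s ≼ k * s
  ≤-scale {s} {k} 0≤s 1≤k = 0≤y-x⇒x≤y (≤-≈ (*-nonneg (x≤y⇒0≤y-x 1≤k) 0≤s)
    (solve 2 (λ k s → (k :- K (+ 1)) :* s := k :* s :- s) refl k s))

  -- In a complete ordered field a nonnegative y with y² ≤ 0 vanishes: the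
  -- multiples m·y are bounded by 1, and their least upper bound s satisfies
  -- s ≤ s − y, since s − y bounds every m·y = (m+1)·y − y.
  nonneg-square-zero : ∀ {y} → 0# ≼ y → y * y ≼ 0# → y ≈ 0#
  nonneg-square-zero {y} 0≤y y²≤0 = O.antisym y≤0 0≤y
    where
    multiples-bounded : ∀ m → fromℕ m * y ≼ 1#
    multiples-bounded m with O.total (fromℕ m * y) 1#
    ... | inj₁ my≤1 = my≤1
    ... | inj₂ 1≤my = ⊥-elim (0≉1 (O.antisym 0≤1 1≤0))
      where
      1≤0 : 1# ≼ 0#
      1≤0 = ≈-≤ (sym (*-identityˡ 1#)) (O.trans (square-mono 0≤1 1≤my)
              (≈-≤ (solve 2 (λ m y → (m :* y) :* (m :* y) := (m :* m) :* (y :* y)) refl (fromℕ m) y)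
                   (*-nonneg-nonpos (square-nonneg (fromℕ m)) y²≤0)))
    Multiple : Carrier → Set c
    Multiple z = Σ ℕ λ m → z ≡ fromℕ m * y
    UpperBound : Carrier → Set (c ⊔ ℓ₂)
    UpperBound b = ∀ z → Multiple z → z ≼ b
    supremum : Σ Carrier (λ s → UpperBound s × (∀ b → UpperBound b → s ≼ b))
    supremum = lub Multiple (fromℕ 0 * y , 0 , ≡.refl)
                            (1# , λ { z (m , ≡.refl) → multiples-bounded m })
    s : Carrier
    s = proj₁ supremum
    shifted-upper : UpperBound (s - y)
    shifted-upper z (m , ≡.refl) =
      0≤y-x⇒x≤y (≤-≈ (x≤y⇒0≤y-x (proj₁ (proj₂ supremum) _ (suc m , ≡.refl)))
        (solve 3 (λ s m y → s :- (K (+ 1) :+ m) :* y := (s :- y) :- m :* y) refl s (fromℕ m) y))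
    y≤0 : y ≼ 0#
    y≤0 = 0≤-x⇒x≤0 (≤-≈ (x≤y⇒0≤y-x (proj₂ (proj₂ supremum) (s - y) shifted-upper))
            (solve 2 (λ s y → (s :- y) :- s := :- y) refl s y))

  square-zero : ∀ {x} → x * x ≼ 0# → x ≈ 0#
  square-zero {x} x²≤0 with O.total 0# x
  ... | inj₁ 0≤x = nonneg-square-zero 0≤x x²≤0
  ... | inj₂ x≤0 = trans (sym (-‿involutive x)) (trans (-‿cong -x≈0) -0#≈0#)
    where
    -x≈0 : - x ≈ 0#
    -x≈0 = nonneg-square-zero (x≤0⇒0≤-x x≤0)
             (≈-≤ (solve 1 (λ x → :- x :* :- x := x :* x) refl x) x²≤0)

  -- For a, b, c ∈ [−1, 1]:  −(ab + bc + ca) ≤ 1, because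
  -- (1+a)(1+b)(1+c) + (1−a)(1−b)(1−c) = 2(1 + ab + bc + ca) ≥ 0.
  cyclic-bound : ∀ {a b c} → - 1# ≼ a → a ≼ 1# → - 1# ≼ b → b ≼ 1# → - 1# ≼ c → c ≼ 1# →
                 - (a * b + (b * c + c * a)) ≼ 1#
  cyclic-bound {a} {b} {c} -1≤a a≤1 -1≤b b≤1 -1≤c c≤1 =
    0≤y-x⇒x≤y (double-nonneg (≤-≈ products-nonneg products≈))
    where
    above : ∀ {x} → - 1# ≼ x → 0# ≼ 1# + x
    above {x} -1≤x = ≤-≈ (x≤y⇒0≤y-x -1≤x) (trans (+-congˡ (-‿involutive 1#)) (+-comm x 1#))
    below : ∀ {x} → x ≼ 1# → 0# ≼ 1# - x
    below = x≤y⇒0≤y-x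
    q : Carrier
    q = - (a * b + (b * c + c * a))
    products-nonneg : 0# ≼ (1# + a) * (1# + b) * (1# + c) + (1# - a) * (1# - b) * (1# - c)
    products-nonneg = +-nonneg (*-nonneg (*-nonneg (above -1≤a) (above -1≤b)) (above -1≤c))
                               (*-nonneg (*-nonneg (below a≤1) (below b≤1)) (below c≤1))
    products≈ : (1# + a) * (1# + b) * (1# + c) + (1# - a) * (1# - b) * (1# - c) ≈ (1# - q) + (1# - q)
    products≈ = solve 3 (λ a b c →
                  (K (+ 1) :+ a) :* (K (+ 1) :+ b) :* (K (+ 1) :+ c)
                    :+ (K (+ 1) :- a) :* (K (+ 1) :- b) :* (K (+ 1) :- c)
                  := (K (+ 1) :- :- (a :* b :+ (b :* c :+ c :* a)))
                    :+ (K (+ 1) :- :- (a :* b :+ (b :* c :+ c :* a))))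
                refl a b c

  ∑-nonneg : ∀ {m} (f : Fin m → Carrier) → (∀ i → 0# ≼ f i) → 0# ≼ ∑ f
  ∑-nonneg {zero}  f 0≤f = O.refl
  ∑-nonneg {suc m} f 0≤f = +-nonneg (0≤f fzero) (∑-nonneg (f ∘ fsuc) (0≤f ∘ fsuc))

  ∑-mono : ∀ {m} (f g : Fin m → Carrier) → (∀ i → f i ≼ g i) → ∑ f ≼ ∑ g
  ∑-mono f g f≤g = 0≤y-x⇒x≤y (≤-≈ (∑-nonneg (λ i → g i - f i) (x≤y⇒0≤y-x ∘ f≤g))
                                  (trans (∑-+ g (λ i → - f i)) (+-congˡ (∑-neg f))))

  term≤∑ : ∀ {m} (f : Fin m → Carrier) → (∀ i → 0# ≼ f i) → ∀ i → f i ≼ ∑ f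
  term≤∑ {suc m} f 0≤f fzero    =
    ≈-≤ (sym (+-identityʳ _)) (+-monoˡ-≤ (f fzero) (∑-nonneg (f ∘ fsuc) (0≤f ∘ fsuc)))
  term≤∑ {suc m} f 0≤f (fsuc i) =
    O.trans (term≤∑ (f ∘ fsuc) (0≤f ∘ fsuc) i) (≈-≤ (sym (+-identityˡ _)) (+-monoʳ-≤ _ (0≤f fzero)))

  ∑³ : ∀ {n} → (Fin n → Fin n → Fin n → Carrier) → Carrier
  ∑³ f = ∑ (λ i → ∑ (λ k → ∑ (λ l → f i k l)))

  ∑³-+ : ∀ {n} (f g : Fin n → Fin n → Fin n → Carrier) →
         ∑³ (λ i k l → f i k l + g i k l) ≈ ∑³ f + ∑³ g
  ∑³-+ {n} f g = trans (∑-cong {n} (λ i → trans (∑-cong {n} (λ k → ∑-+ {n} _ _)) (∑-+ {n} _ _))) (∑-+ {n} _ _)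

  ∑³-mono : ∀ {n} (f g : Fin n → Fin n → Fin n → Carrier) → (∀ i k l → f i k l ≼ g i k l) → ∑³ f ≼ ∑³ g
  ∑³-mono f g f≤g = ∑-mono _ _ (λ i → ∑-mono _ _ (λ k → ∑-mono _ _ (f≤g i k)))

  ∑³-1 : ∀ n → ∑³ {n} (λ _ _ _ → 1#) ≈ fromℕ n * (fromℕ n * fromℕ n)
  ∑³-1 n = trans (∑-cong {n} (λ i → trans (∑-cong {n} (λ k → trans (∑-const n 1#) (*-identityʳ _)))
                                         (∑-const n (fromℕ n))))
                 (∑-const n (fromℕ n * fromℕ n))

  ∑³-rotate : ∀ {n} (f : Fin n → Fin n → Fin n → Carrier) → ∑³ (λ i k l → f k l i) ≈ ∑³ f
  ∑³-rotate {n} f = trans (∑-swap (λ i k → ∑ (λ l → f k l i))) (∑-cong {n} (λ k → ∑-swap (λ i l → f k l i)))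

  σ : ∀ {n} → Vector n → Carrier
  σ v = ∑ v

  ⟨_,_⟩ : ∀ {n} → Vector n → Vector n → Carrier
  ⟨ u , v ⟩ = ∑ (λ i → u i * v i)

  krylov : ∀ {n} → Matrix n → ℕ → Vector n
  krylov {n} B zero    = ones n
  krylov     B (suc p) = B · krylov B p

  module _ {n : ℕ} where
    ·-cong : ∀ (A : Matrix n) {u w : Vector n} → (∀ k → u k ≈ w k) → ∀ i → (A · u) i ≈ (A · w) i
    ·-cong A u≈w i = ∑-cong {n} (λ k → *-congˡ (u≈w k))

    ·-assoc : ∀ (A C : Matrix n) (u : Vector n) i → ((A ⊗ C) · u) i ≈ (A · (C · u)) i
    ·-assoc A C u i = begin
      ∑ (λ k → ∑ (λ l → A i l * C l k) * u k)  ≈⟨ ∑-cong {n} (λ k → sym (∑-*ʳ (u k) (λ l → A i l * C l k))) ⟩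
      ∑ (λ k → ∑ (λ l → A i l * C l k * u k))  ≈⟨ ∑-swap (λ k l → A i l * C l k * u k) ⟩
      ∑ (λ l → ∑ (λ k → A i l * C l k * u k))  ≈⟨ ∑-cong {n} (λ l → trans (∑-cong {n} (λ k → *-assoc _ _ _))
                                                                        (∑-*ˡ (A i l) (λ k → C l k * u k))) ⟩
      ∑ (λ l → A i l * ∑ (λ k → C l k * u k))  ∎

    ⊗-assoc : ∀ (A C D : Matrix n) i l → ((A ⊗ C) ⊗ D) i l ≈ (A ⊗ (C ⊗ D)) i l
    ⊗-assoc A C D i l = ·-assoc A C (λ k → D k l) i

    ⊗-congˡ : ∀ (A : Matrix n) {C D : Matrix n} → (∀ k l → C k l ≈ D k l) → ∀ i l → (A ⊗ C) i l ≈ (A ⊗ D) i l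
    ⊗-congˡ A C≈D i l = ∑-cong {n} (λ k → *-congˡ (C≈D k l))

    ⊗-congʳ : ∀ {A C : Matrix n} (D : Matrix n) → (∀ i k → A i k ≈ C i k) → ∀ i l → (A ⊗ D) i l ≈ (C ⊗ D) i l
    ⊗-congʳ D A≈C i l = ∑-cong {n} (λ k → *-congʳ (A≈C i k))

    ⊗-distribˡ : ∀ (A C D : Matrix n) i l → (A ⊗ (C ⊕ D)) i l ≈ (A ⊗ C) i l + (A ⊗ D) i l
    ⊗-distribˡ A C D i l = trans (∑-cong {n} (λ k → distribˡ _ _ _)) (∑-+ {n} _ _)

    ⊗-distribʳ : ∀ (A C D : Matrix n) i l → ((A ⊕ C) ⊗ D) i l ≈ (A ⊗ D) i l + (C ⊗ D) i l
    ⊗-distribʳ A C D i l = trans (∑-cong {n} (λ k → distribʳ _ _ _)) (∑-+ {n} _ _)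

    ^-comm : ∀ (A : Matrix n) q i l → ((A ^ q) ⊗ A) i l ≈ (A ⊗ (A ^ q)) i l
    ^-comm A zero    i l = trans (∑-identityˡ i (λ k → A k l)) (sym (∑-identityʳ l (A i)))
    ^-comm A (suc q) i l = trans (⊗-assoc A (A ^ q) A i l) (⊗-congˡ A (^-comm A q) i l)

    trace-through-J : ∀ (A X : Matrix n) → Tr (A ⊗ (J n ⊗ X)) ≈ σ (X · (A · ones n))
    trace-through-J A X = begin
      ∑ (λ i → ∑ (λ k → A i k * ∑ (λ l → 1# * X l i)))
        ≈⟨ ∑-cong {n} (λ i → ∑-cong {n} (λ k → *-congˡ (∑-cong {n} (λ l → *-identityˡ _)))) ⟩
      ∑ (λ i → ∑ (λ k → A i k * ∑ (λ l → X l i)))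
        ≈⟨ ∑-cong {n} (λ i → trans (∑-*ʳ _ (A i)) (*-congʳ (∑-cong {n} (λ k → sym (*-identityʳ _))))) ⟩
      ∑ (λ i → (A · ones n) i * ∑ (λ l → X l i))
        ≈⟨ ∑-cong {n} (λ i → trans (sym (∑-*ˡ _ (λ l → X l i))) (∑-cong {n} (λ l → *-comm _ _))) ⟩
      ∑ (λ i → ∑ (λ l → X l i * (A · ones n) i))
        ≈⟨ ∑-swap (λ i l → X l i * (A · ones n) i) ⟩
      σ (X · (A · ones n)) ∎

    J-power : ∀ k i l → (J n ^ suc k) i l ≈ fromℕ n ^ᴿ k
    J-power zero    i l = ∑-identityʳ l (λ _ → 1#)
    J-power (suc k) i l = trans (∑-cong {n} (λ m → trans (*-identityˡ _) (J-power k m l)))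
                                (∑-const n (fromℕ n ^ᴿ k))

    trace-J-power : ∀ k → Tr (J n ^ suc k) ≈ fromℕ n ^ᴿ suc k
    trace-J-power k = trans (∑-cong {n} (λ i → J-power k i i)) (∑-const n (fromℕ n ^ᴿ k))

  -- Symbolic bookkeeping for the expansion of Tr (J + B)ᵏ.  A combination
  -- ∑ α_p x_p of Krylov vectors is stored as the coefficient vector α, and
  -- the polynomial `moment p` stands for σ(x_p).
  module Coefficients {m : ℕ} (moment : ℕ → Polynomial m) where
    pairing : ∀ {k} → Vec (Polynomial m) k → (ℕ → Polynomial m) → Polynomial m
    pairing []      μ = K (+ 0)
    pairing (a ∷ α) μ = a :* μ 0 :+ pairing α (μ ∘ suc)

    -- (J + B) ∑ α_p x_p = σ(∑ α_p x_p) x_0 + ∑ α_p x_{p+1}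
    advance : ∀ {k} → Vec (Polynomial m) k → Vec (Polynomial m) (suc k)
    advance α = pairing α moment ∷ α

    advanceⁿ : ∀ {k} a → Vec (Polynomial m) k → Vec (Polynomial m) (a ℕ.+ k)
    advanceⁿ zero    α = α
    advanceⁿ (suc a) α = advance (advanceⁿ a α)

    unit : ∀ q → Vec (Polynomial m) (suc q)
    unit zero    = K (+ 1) ∷ []
    unit (suc q) = K (+ 0) ∷ unit q

    -- expansion q a stands for Tr(B^q (J + B)^a) − Tr(B^{q+a})
    expansion : ℕ → ℕ → Polynomial m
    expansion q zero    = K (+ 0)
    expansion q (suc a) = pairing (advanceⁿ a (unit q)) moment :+ expansion (suc q) a

  module RankOneExpansion {n m : ℕ} (B : Matrix n) (moment : ℕ → Polynomial m)
                          (ρ : Vec Carrier m) where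
    open Coefficients moment

    M : Matrix n
    M = J n ⊕ B

    x : ℕ → Vector n
    x = krylov B

    ⟪_⟫ : Polynomial m → Carrier
    ⟪ p ⟫ = ⟦ p ⟧ ρ

    Represents : ℕ → Set ℓ₁
    Represents k = ∀ p → p ℕ.< k → ⟪ moment p ⟫ ≈ σ (x p)

    represents-≤ : ∀ {k k′} → k′ ℕ.≤ k → Represents k → Represents k′
    represents-≤ k′≤k rep p p<k′ = rep p (ℕP.<-≤-trans p<k′ k′≤k)

    combination : ∀ {k} → Vec (Polynomial m) k → (ℕ → Vector n) → Vector n
    combination []      y i = 0#
    combination (a ∷ α) y i = ⟪ a ⟫ * y 0 i + combination α (y ∘ suc) i

    σ-combination : ∀ {k} (α : Vec (Polynomial m) k) μ y → (∀ p → p ℕ.< k → ⟪ μ p ⟫ ≈ σ (y p)) →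
                    σ (combination α y) ≈ ⟪ pairing α μ ⟫
    σ-combination []      μ y μ≈σy = ∑-0 n
    σ-combination (a ∷ α) μ y μ≈σy = begin
      ∑ (λ i → ⟪ a ⟫ * y 0 i + combination α (y ∘ suc) i)    ≈⟨ ∑-+ {n} _ _ ⟩
      ∑ (λ i → ⟪ a ⟫ * y 0 i) + σ (combination α (y ∘ suc))  ≈⟨ +-cong head tail ⟩
      ⟪ a ⟫ * ⟪ μ 0 ⟫ + ⟪ pairing α (μ ∘ suc) ⟫              ∎
      where
      head : ∑ (λ i → ⟪ a ⟫ * y 0 i) ≈ ⟪ a ⟫ * ⟪ μ 0 ⟫
      head = trans (∑-*ˡ {n} _ _) (*-congˡ (sym (μ≈σy 0 (ℕ.s≤s ℕ.z≤n))))
      tail : σ (combination α (y ∘ suc)) ≈ ⟪ pairing α (μ ∘ suc) ⟫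
      tail = σ-combination α (μ ∘ suc) (y ∘ suc) (λ p p<k → μ≈σy (suc p) (ℕ.s≤s p<k))

    B-combination : ∀ {k} (α : Vec (Polynomial m) k) y i →
                    (B · combination α y) i ≈ combination α (λ p → B · y p) i
    B-combination []      y i = trans (∑-cong {n} (λ k → zeroʳ _)) (∑-0 n)
    B-combination (a ∷ α) y i = begin
      ∑ (λ k → B i k * (⟪ a ⟫ * y 0 k + combination α (y ∘ suc) k))
        ≈⟨ trans (∑-cong {n} (λ k → distribˡ _ _ _)) (∑-+ {n} _ _) ⟩
      ∑ (λ k → B i k * (⟪ a ⟫ * y 0 k)) + (B · combination α (y ∘ suc)) i
        ≈⟨ +-cong (trans (∑-cong {n} (λ k → x*yz≈y*xz _ _ _)) (∑-*ˡ {n} _ _)) (B-combination α (y ∘ suc) i) ⟩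
      ⟪ a ⟫ * (B · y 0) i + combination α (λ p → B · y (suc p)) i ∎

    M-action : ∀ w i → (M · w) i ≈ σ w + (B · w) i
    M-action w i = trans (∑-cong {n} (λ k → trans (distribʳ _ _ _) (+-congʳ (*-identityˡ _)))) (∑-+ {n} _ _)

    M-combination : ∀ {k} (α : Vec (Polynomial m) k) → Represents k →
                    ∀ i → (M · combination α x) i ≈ combination (advance α) x i
    M-combination α rep i = begin
      (M · combination α x) i                         ≈⟨ M-action _ i ⟩
      σ (combination α x) + (B · combination α x) i   ≈⟨ +-cong (trans (σ-combination α moment x rep) (sym (*-identityʳ _)))
                                                                (B-combination α x i) ⟩
      ⟪ pairing α moment ⟫ * 1# + combination α (λ p → B · x p) i ∎

    Mⁿ-combination : ∀ {k} a (α : Vec (Polynomial m) k) → Represents (a ℕ.+ k) →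
                     ∀ i → ((M ^ a) · combination α x) i ≈ combination (advanceⁿ a α) x i
    Mⁿ-combination zero    α rep i = ∑-identityˡ i _
    Mⁿ-combination {k} (suc a) α rep i = begin
      ((M ⊗ (M ^ a)) · combination α x) i   ≈⟨ ·-assoc M (M ^ a) _ i ⟩
      (M · ((M ^ a) · combination α x)) i   ≈⟨ ·-cong M (Mⁿ-combination a α rep′) i ⟩
      (M · combination (advanceⁿ a α) x) i  ≈⟨ M-combination (advanceⁿ a α) rep′ i ⟩
      combination (advanceⁿ (suc a) α) x i  ∎
      where
      rep′ : Represents (a ℕ.+ k)
      rep′ = represents-≤ (ℕP.n≤1+n _) rep

    combination-unit : ∀ q y i → combination (unit q) y i ≈ y q i
    combination-unit zero    y i = trans (+-identityʳ _) (*-identityˡ _)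
    combination-unit (suc q) y i = trans (+-cong (zeroˡ _) (combination-unit q (y ∘ suc) i)) (+-identityˡ _)

    krylov-power : ∀ q i → ((B ^ q) · ones n) i ≈ x q i
    krylov-power zero    i = ∑-identityˡ i _
    krylov-power (suc q) i = trans (·-assoc B (B ^ q) _ i) (·-cong B (krylov-power q) i)

    moment-of-power : ∀ q a → Represents (a ℕ.+ suc q) →
                      σ ((M ^ a) · ((B ^ q) · ones n)) ≈ ⟪ pairing (advanceⁿ a (unit q)) moment ⟫
    moment-of-power q a rep = begin
      σ ((M ^ a) · ((B ^ q) · ones n))          ≈⟨ ∑-cong {n} (·-cong (M ^ a) (λ k → trans (krylov-power q k)
                                                                 (sym (combination-unit q x k)))) ⟩
      σ ((M ^ a) · combination (unit q) x)      ≈⟨ ∑-cong {n} (Mⁿ-combination a (unit q) rep) ⟩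
      σ (combination (advanceⁿ a (unit q)) x)   ≈⟨ σ-combination (advanceⁿ a (unit q)) moment x rep ⟩
      ⟪ pairing (advanceⁿ a (unit q)) moment ⟫  ∎

    trace-peel : ∀ q a → Tr ((B ^ q) ⊗ (M ^ suc a)) ≈ σ ((M ^ a) · ((B ^ q) · ones n)) + Tr ((B ^ suc q) ⊗ (M ^ a))
    trace-peel q a = begin
      Tr ((B ^ q) ⊗ (M ⊗ (M ^ a)))
        ≈⟨ ∑-cong {n} (λ i → trans (⊗-congˡ (B ^ q) (⊗-distribʳ (J n) B (M ^ a)) i i)
                                   (⊗-distribˡ (B ^ q) (J n ⊗ (M ^ a)) (B ⊗ (M ^ a)) i i)) ⟩
      ∑ (λ i → ((B ^ q) ⊗ (J n ⊗ (M ^ a))) i i + ((B ^ q) ⊗ (B ⊗ (M ^ a))) i i)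
        ≈⟨ ∑-+ {n} _ _ ⟩
      Tr ((B ^ q) ⊗ (J n ⊗ (M ^ a))) + Tr ((B ^ q) ⊗ (B ⊗ (M ^ a)))
        ≈⟨ +-cong (trace-through-J (B ^ q) (M ^ a))
                  (∑-cong {n} (λ i → trans (sym (⊗-assoc (B ^ q) B (M ^ a) i i))
                                           (⊗-congʳ (M ^ a) (^-comm B q) i i))) ⟩
      σ ((M ^ a) · ((B ^ q) · ones n)) + Tr ((B ^ suc q) ⊗ (M ^ a)) ∎

    trace-BqMa : ∀ a q → Represents (q ℕ.+ a) →
                 Tr ((B ^ q) ⊗ (M ^ a)) ≈ ⟪ expansion q a ⟫ + Tr (B ^ (q ℕ.+ a))
    trace-BqMa zero    q rep = begin
      Tr ((B ^ q) ⊗ identity)  ≈⟨ ∑-cong {n} (λ i → ∑-identityʳ i _) ⟩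
      Tr (B ^ q)               ≈⟨ reflexive (≡.cong (λ r → Tr (B ^ r)) (ℕP.+-identityʳ q)) ⟨
      Tr (B ^ (q ℕ.+ 0))       ≈⟨ +-identityˡ _ ⟨
      0# + Tr (B ^ (q ℕ.+ 0))  ∎
    trace-BqMa (suc a) q rep = begin
      Tr ((B ^ q) ⊗ (M ^ suc a))
        ≈⟨ trace-peel q a ⟩
      σ ((M ^ a) · ((B ^ q) · ones n)) + Tr ((B ^ suc q) ⊗ (M ^ a))
        ≈⟨ +-cong (moment-of-power q a (represents-≤ (ℕP.≤-reflexive a+[1+q]≡q+[1+a]) rep))
                  (trace-BqMa a (suc q) (represents-≤ (ℕP.≤-reflexive (≡.sym (ℕP.+-suc q a))) rep)) ⟩
      ⟪ pairing (advanceⁿ a (unit q)) moment ⟫ + (⟪ expansion (suc q) a ⟫ + Tr (B ^ (suc q ℕ.+ a)))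
        ≈⟨ +-assoc _ _ _ ⟨
      ⟪ expansion q (suc a) ⟫ + Tr (B ^ suc (q ℕ.+ a))
        ≈⟨ +-congˡ (reflexive (≡.cong (λ r → Tr (B ^ r)) (ℕP.+-suc q a))) ⟨
      ⟪ expansion q (suc a) ⟫ + Tr (B ^ (q ℕ.+ suc a)) ∎
      where
      a+[1+q]≡q+[1+a] : a ℕ.+ suc q ≡ q ℕ.+ suc a
      a+[1+q]≡q+[1+a] = ≡.trans (ℕP.+-comm a (suc q)) (≡.sym (ℕP.+-suc q a))

    trace-expansion : ∀ k → Represents k → Tr (M ^ k) ≈ ⟪ expansion 0 k ⟫ + Tr (B ^ k)
    trace-expansion k rep =
      trans (∑-cong {n} (λ i → sym (∑-identityˡ i (λ l → (M ^ k) l i)))) (trace-BqMa k 0 rep)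

  alternate : ℕ → Carrier → Carrier
  alternate zero    a = a
  alternate (suc k) a = - alternate k a

  alternate-cong : ∀ k {a b} → a ≈ b → alternate k a ≈ alternate k b
  alternate-cong zero    a≈b = a≈b
  alternate-cong (suc k) a≈b = -‿cong (alternate-cong k a≈b)

  alternate-0 : ∀ k → alternate k 0# ≈ 0#
  alternate-0 zero    = refl
  alternate-0 (suc k) = trans (-‿cong (alternate-0 k)) -0#≈0#

  closed⁴ : ∀ {m} (N S : Polynomial m) → Polynomial m
  closed⁴ N S = N :^ 4 :- K (+ 4) :* N :* S

  closed⁸ : ∀ {m} (N S T U : Polynomial m) → Polynomial m
  closed⁸ N S T U = N :^ 8 :- K (+ 8) :* N :^ 5 :* S :+ K (+ 8) :* N :^ 3 :* T
                    :+ K (+ 12) :* N :^ 2 :* S :* S :- K (+ 8) :* N :* U :- K (+ 8) :* S :* T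

  -- A nonempty index type gives n ≥ 1, so the weights 4n and 2n⁵ are ≥ 1.
  1≤fromℕ[4n] : ∀ {n} → Fin n → 1# ≼ fromℕ (4 ℕ.* n)
  1≤fromℕ[4n] {suc n} _ = 1≤fromℕ (4 ℕ.* suc n) (ℕ.s≤s ℕ.z≤n)

  1≤fromℕ[2n⁵] : ∀ {n} → Fin n → 1# ≼ fromℕ (2 ℕ.* (n ℕ.^ 5))
  1≤fromℕ[2n⁵] {suc n} _ = 1≤fromℕ (2 ℕ.* (suc n ℕ.^ 5)) (ℕ.s≤s ℕ.z≤n)

  module Skew {n : ℕ} (B : Matrix n) (skew : SkewSymmetric B) where
    x : ℕ → Vector n
    x = krylov B

    N s t u : Carrier
    N = fromℕ n
    s = ‖ x 1 ‖²
    t = ‖ x 2 ‖²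
    u = ‖ x 3 ‖²

    ⟨⟩-comm : ∀ (v w : Vector n) → ⟨ v , w ⟩ ≈ ⟨ w , v ⟩
    ⟨⟩-comm v w = ∑-cong {n} (λ i → *-comm (v i) (w i))

    adjoint : ∀ (v w : Vector n) → ⟨ B · v , w ⟩ ≈ - ⟨ v , B · w ⟩
    adjoint v w = begin
      ∑ (λ i → ∑ (λ k → B i k * v k) * w i)  ≈⟨ ∑-cong {n} (λ i → sym (∑-*ʳ (w i) (λ k → B i k * v k))) ⟩
      ∑ (λ i → ∑ (λ k → B i k * v k * w i))  ≈⟨ ∑-swap (λ i k → B i k * v k * w i) ⟩
      ∑ (λ k → ∑ (λ i → B i k * v k * w i))  ≈⟨ ∑-cong {n} (λ k → ∑-cong {n} (λ i → entry i k)) ⟩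
      ∑ (λ k → ∑ (λ i → - (v k * (B k i * w i))))
        ≈⟨ ∑-cong {n} (λ k → trans (∑-neg (λ i → v k * (B k i * w i))) (-‿cong (∑-*ˡ (v k) (λ i → B k i * w i)))) ⟩
      ∑ (λ k → - (v k * (B · w) k))          ≈⟨ ∑-neg (λ k → v k * (B · w) k) ⟩
      - ⟨ v , B · w ⟩                        ∎
      where
      entry : ∀ i k → B i k * v k * w i ≈ - (v k * (B k i * w i))
      entry i k = trans (*-congʳ (*-congʳ (skew i k)))
                        (solve 3 (λ b a c → :- b :* a :* c := :- (a :* (b :* c))) refl (B k i) (v k) (w i))

    self-orthogonal : ∀ (v : Vector n) → ⟨ B · v , v ⟩ ≈ 0#
    self-orthogonal v = x≈-x⇒x≈0 (trans (adjoint v v) (-‿cong (⟨⟩-comm v (B · v))))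

    transfer : ∀ k p q → ⟨ x (k ℕ.+ p) , x q ⟩ ≈ alternate k ⟨ x p , x (k ℕ.+ q) ⟩
    transfer zero    p q = refl
    transfer (suc k) p q = begin
      ⟨ B · x (k ℕ.+ p) , x q ⟩                ≈⟨ adjoint (x (k ℕ.+ p)) (x q) ⟩
      - ⟨ x (k ℕ.+ p) , x (suc q) ⟩            ≈⟨ -‿cong (transfer k p (suc q)) ⟩
      - alternate k ⟨ x p , x (k ℕ.+ suc q) ⟩  ≈⟨ reflexive (≡.cong (λ r → - alternate k ⟨ x p , x r ⟩) (ℕP.+-suc k q)) ⟩
      - alternate k ⟨ x p , x (suc k ℕ.+ q) ⟩  ∎

    σ≈⟨⟩ : ∀ (v : Vector n) → σ v ≈ ⟨ v , x 0 ⟩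
    σ≈⟨⟩ v = ∑-cong {n} (λ i → sym (*-identityʳ _))

    even-moment : ∀ m → σ (x (m ℕ.+ m)) ≈ alternate m ‖ x m ‖²
    even-moment m = trans (σ≈⟨⟩ _) (trans (transfer m m 0)
                      (reflexive (≡.cong (λ r → alternate m ⟨ x m , x r ⟩) (ℕP.+-identityʳ m))))

    odd-moment : ∀ m → σ (x (m ℕ.+ suc m)) ≈ 0#
    odd-moment m = begin
      σ (x (m ℕ.+ suc m))                       ≈⟨ σ≈⟨⟩ _ ⟩
      ⟨ x (m ℕ.+ suc m) , x 0 ⟩                 ≈⟨ transfer m (suc m) 0 ⟩
      alternate m ⟨ B · x m , x (m ℕ.+ 0) ⟩     ≈⟨ reflexive (≡.cong (λ r → alternate m ⟨ B · x m , x r ⟩) (ℕP.+-identityʳ m)) ⟩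
      alternate m ⟨ B · x m , x m ⟩             ≈⟨ alternate-cong m (self-orthogonal (x m)) ⟩
      alternate m 0#                            ≈⟨ alternate-0 m ⟩
      0#                                        ∎

    -- The variables n, s, t, u, and the symbolic moments σ(x_0), …, σ(x_7):
    -- σ(x_0) = n, σ(x_{2m}) = (−1)ᵐ‖x_m‖², and the odd moments vanish.
    valuation : Vec Carrier 4
    valuation = N ∷ s ∷ t ∷ u ∷ []

    vN vS vT vU : Polynomial 4
    vN = var fzero
    vS = var (fsuc fzero)
    vT = var (fsuc (fsuc fzero))
    vU = var (fsuc (fsuc (fsuc fzero)))

    moment : ℕ → Polynomial 4
    moment 0 = vN
    moment 2 = :- vS
    moment 4 = :- :- vT
    moment 6 = :- :- :- vU
    moment _ = K (+ 0)

    open Coefficients moment using (expansion)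
    open RankOneExpansion B moment valuation using (M; Represents; represents-≤; trace-expansion)

    represents : Represents 8
    represents 0 _ = sym (trans (∑-const n 1#) (*-identityʳ N))
    represents 1 _ = sym (odd-moment 0)
    represents 2 _ = sym (even-moment 1)
    represents 3 _ = sym (odd-moment 1)
    represents 4 _ = sym (even-moment 2)
    represents 5 _ = sym (odd-moment 2)
    represents 6 _ = sym (even-moment 3)
    represents 7 _ = sym (odd-moment 3)
    represents (suc (suc (suc (suc (suc (suc (suc (suc _))))))))
               (ℕ.s≤s (ℕ.s≤s (ℕ.s≤s (ℕ.s≤s (ℕ.s≤s (ℕ.s≤s (ℕ.s≤s (ℕ.s≤s ()))))))))

    trace⁴-closed : Tr (M ^ 4) ≈ ⟦ closed⁴ vN vS ⟧ valuation + Tr (B ^ 4)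
    trace⁴-closed = trans (trace-expansion 4 (represents-≤ (ℕP.m≤m+n 4 4) represents))
                          (+-congʳ (prove valuation (expansion 0 4) (closed⁴ vN vS) refl))

    trace⁸-closed : Tr (M ^ 8) ≈ ⟦ closed⁸ vN vS vT vU ⟧ valuation + Tr (B ^ 8)
    trace⁸-closed = trans (trace-expansion 8 represents)
                          (+-congʳ (prove valuation (expansion 0 8) (closed⁸ vN vS vT vU) refl))

    X⁴ X⁸ w⁴ w⁸ : Carrier
    X⁴ = Tr (J n ^ 4) + Tr (B ^ 4)
    X⁸ = Tr (J n ^ 8) + Tr (B ^ 8)
    w⁴ = fromℕ (4 ℕ.* n)
    w⁸ = fromℕ (2 ℕ.* (n ℕ.^ 5))

    trace⁴ : Tr (M ^ 4) ≈ X⁴ - w⁴ * s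
    trace⁴ = begin
      Tr (M ^ 4)                                   ≈⟨ trace⁴-closed ⟩
      ⟦ closed⁴ vN vS ⟧ valuation + Tr (B ^ 4)     ≈⟨ solve 3 (λ N S TB → closed⁴ N S :+ TB := (N :^ 4 :+ TB) :- (K (+ 4) :* N) :* S)
                                                            refl N s (Tr (B ^ 4)) ⟩
      (N ^ᴿ 4 + Tr (B ^ 4)) - (⟦ + 4 ⟧ℤ * N) * s  ≈⟨ +-cong (+-congʳ (trace-J-power {n} 3)) (-‿cong (*-congʳ w⁴≈4n)) ⟨
      X⁴ - w⁴ * s                                  ∎
      where
      w⁴≈4n : w⁴ ≈ ⟦ + 4 ⟧ℤ * N
      w⁴≈4n = trans (fromℕ-* 4 n) (*-congʳ (fromℕ≈numeral 4))

    z : Vector n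
    z i = (N * N) * x 1 i + ⟦ + 2 ⟧ℤ * x 3 i

    ⟨x₁,x₃⟩≈-t : ⟨ x 1 , x 3 ⟩ ≈ - t
    ⟨x₁,x₃⟩≈-t = trans (sym (-‿involutive _)) (-‿cong (sym (adjoint (x 1) (x 2))))

    ‖z‖² : ‖ z ‖² ≈ N ^ᴿ 4 * s + (⟦ + 4 ⟧ℤ * (N * N)) * - t + ⟦ + 4 ⟧ℤ * u
    ‖z‖² = begin
      ∑ (λ i → z i * z i)
        ≈⟨ ∑-cong {n} (λ i → solve 3 (λ N a b → ((N :* N) :* a :+ K (+ 2) :* b) :* ((N :* N) :* a :+ K (+ 2) :* b)
                                               := N :^ 4 :* (a :* a) :+ (K (+ 4) :* (N :* N)) :* (a :* b) :+ K (+ 4) :* (b :* b))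
                                        refl N (x 1 i) (x 3 i)) ⟩
      ∑ (λ i → N ^ᴿ 4 * (x 1 i * x 1 i) + (⟦ + 4 ⟧ℤ * (N * N)) * (x 1 i * x 3 i) + ⟦ + 4 ⟧ℤ * (x 3 i * x 3 i))
        ≈⟨ trans (∑-+ {n} _ _) (+-congʳ (∑-+ {n} _ _)) ⟩
      ∑ (λ i → N ^ᴿ 4 * (x 1 i * x 1 i)) + ∑ (λ i → (⟦ + 4 ⟧ℤ * (N * N)) * (x 1 i * x 3 i))
        + ∑ (λ i → ⟦ + 4 ⟧ℤ * (x 3 i * x 3 i))
        ≈⟨ +-cong (+-cong (∑-*ˡ {n} _ _) (trans (∑-*ˡ {n} _ _) (*-congˡ ⟨x₁,x₃⟩≈-t))) (∑-*ˡ {n} _ _) ⟩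
      N ^ᴿ 4 * s + (⟦ + 4 ⟧ℤ * (N * N)) * - t + ⟦ + 4 ⟧ℤ * u ∎

    slack⁸ : (X⁸ - w⁸ * s) - Tr (M ^ 8) ≈
             (⟦ + 2 ⟧ℤ * N) * ‖ z ‖² + ((⟦ + 4 ⟧ℤ * (N * N)) * s) * (N * (N * N) - ⟦ + 3 ⟧ℤ * s)
               + (⟦ + 8 ⟧ℤ * s) * t
    slack⁸ = begin
      (X⁸ - w⁸ * s) - Tr (M ^ 8)
        ≈⟨ +-cong (+-cong (+-congʳ (trace-J-power {n} 7)) (-‿cong (*-congʳ w⁸≈2n⁵))) (-‿cong trace⁸-closed) ⟩
      ((N ^ᴿ 8 + Tr (B ^ 8)) - (⟦ + 2 ⟧ℤ * N ^ᴿ 5) * s) - (⟦ closed⁸ vN vS vT vU ⟧ valuation + Tr (B ^ 8))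
        ≈⟨ solve 5 (λ N S T U TB → ((N :^ 8 :+ TB) :- (K (+ 2) :* N :^ 5) :* S) :- (closed⁸ N S T U :+ TB)
                     := (K (+ 2) :* N) :* (N :^ 4 :* S :+ (K (+ 4) :* (N :* N)) :* (:- T) :+ K (+ 4) :* U)
                        :+ ((K (+ 4) :* (N :* N)) :* S) :* (N :* (N :* N) :- K (+ 3) :* S) :+ (K (+ 8) :* S) :* T)
                   refl N s t u (Tr (B ^ 8)) ⟩
      (⟦ + 2 ⟧ℤ * N) * (N ^ᴿ 4 * s + (⟦ + 4 ⟧ℤ * (N * N)) * - t + ⟦ + 4 ⟧ℤ * u)
        + ((⟦ + 4 ⟧ℤ * (N * N)) * s) * (N * (N * N) - ⟦ + 3 ⟧ℤ * s) + (⟦ + 8 ⟧ℤ * s) * t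
        ≈⟨ +-congʳ (+-congʳ (*-congˡ ‖z‖²)) ⟨
      (⟦ + 2 ⟧ℤ * N) * ‖ z ‖² + ((⟦ + 4 ⟧ℤ * (N * N)) * s) * (N * (N * N) - ⟦ + 3 ⟧ℤ * s)
        + (⟦ + 8 ⟧ℤ * s) * t ∎
      where
      w⁸≈2n⁵ : w⁸ ≈ ⟦ + 2 ⟧ℤ * N ^ᴿ 5
      w⁸≈2n⁵ = trans (fromℕ-* 2 (n ℕ.^ 5)) (*-cong (fromℕ≈numeral 2) (fromℕ-^ n 5))

    0≤s : 0# ≼ s
    0≤s = ∑-nonneg {n} _ (λ i → square-nonneg (x 1 i))

    0≤t : 0# ≼ t
    0≤t = ∑-nonneg {n} _ (λ i → square-nonneg (x 2 i))

    row-sum≈x₁ : ∀ i → ∑ (λ j → B i j) ≈ x 1 i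
    row-sum≈x₁ i = ∑-cong {n} (λ j → sym (*-identityʳ (B i j)))

    s≤0⇒row-sums-zero : s ≼ 0# → RowSumsZero B
    s≤0⇒row-sums-zero s≤0 i =
      trans (row-sum≈x₁ i) (square-zero (O.trans (term≤∑ (λ i → x 1 i * x 1 i) (λ i → square-nonneg (x 1 i)) i) s≤0))

    drop-penalty : ∀ {T X w} → 0# ≼ w → T ≼ X - w * s → T ≼ X
    drop-penalty 0≤w T≤X-ws = O.trans T≤X-ws (x-d≤x (*-nonneg 0≤w 0≤s))

    tight⇒row-sums-zero : ∀ {T X w} → (Fin n → 1# ≼ w) → T ≼ X - w * s → T ≈ X → RowSumsZero B
    tight⇒row-sums-zero {T} {X} {w} 1≤w T≤X-ws T≈X i = s≤0⇒row-sums-zero (O.trans (≤-scale 0≤s (1≤w i)) ws≤0) i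
      where
      ws≤0 : w * s ≼ 0#
      ws≤0 = 0≤-x⇒x≤0 (≤-≈ (x≤y⇒0≤y-x (≈-≤ (sym T≈X) T≤X-ws))
                           (solve 2 (λ X W → (X :- W) :- X := :- W) refl X (w * s)))

    row-sums-zero⇒x≈0 : RowSumsZero B → ∀ p i → x (suc p) i ≈ 0#
    row-sums-zero⇒x≈0 rows zero    i = trans (sym (row-sum≈x₁ i)) (rows i)
    row-sums-zero⇒x≈0 rows (suc p) i =
      trans (·-cong B (row-sums-zero⇒x≈0 rows p) i) (trans (∑-cong {n} (λ j → zeroʳ (B i j))) (∑-0 n))

    row-sums-zero⇒‖x‖²≈0 : RowSumsZero B → ∀ p → ‖ x (suc p) ‖² ≈ 0#
    row-sums-zero⇒‖x‖²≈0 rows p =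
      trans (∑-cong {n} (λ i → trans (*-congʳ (row-sums-zero⇒x≈0 rows p i)) (zeroˡ _))) (∑-0 n)

    row-sums-zero⇒trace⁴ : RowSumsZero B → Tr (M ^ 4) ≈ X⁴
    row-sums-zero⇒trace⁴ rows = begin
      Tr (M ^ 4)    ≈⟨ trace⁴ ⟩
      X⁴ - w⁴ * s   ≈⟨ +-congˡ (-‿cong (trans (*-congˡ (row-sums-zero⇒‖x‖²≈0 rows 0)) (zeroʳ w⁴))) ⟩
      X⁴ - 0#       ≈⟨ trans (+-congˡ -0#≈0#) (+-identityʳ X⁴) ⟩
      X⁴            ∎

    row-sums-zero⇒trace⁸ : RowSumsZero B → Tr (M ^ 8) ≈ X⁸
    row-sums-zero⇒trace⁸ rows = begin
      Tr (M ^ 8)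
        ≈⟨ trace⁸-closed ⟩
      ⟦ closed⁸ vN vS vT vU ⟧ valuation + Tr (B ^ 8)
        ≈⟨ +-congʳ (solve 4 (λ N S T U → closed⁸ N S T U
                               := N :^ 8 :+ (S :* (K (+ 12) :* N :^ 2 :* S :- K (+ 8) :* N :^ 5 :- K (+ 8) :* T)
                                             :+ T :* (K (+ 8) :* N :^ 3) :+ U :* (:- (K (+ 8) :* N))))
                             refl N s t u) ⟩
      (N ^ᴿ 8 + (s * _ + t * _ + u * _)) + Tr (B ^ 8)
        ≈⟨ +-congʳ (trans (+-congˡ (trans (+-cong (+-cong (vanish 0) (vanish 1)) (vanish 2))
                                          (trans (+-identityʳ _) (+-identityʳ _))))
                          (+-identityʳ _)) ⟩
      N ^ᴿ 8 + Tr (B ^ 8)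
        ≈⟨ +-congʳ (trace-J-power {n} 7) ⟨
      X⁸ ∎
      where
      vanish : ∀ p {c} → ‖ x (suc p) ‖² * c ≈ 0#
      vanish p = trans (*-congʳ (row-sums-zero⇒‖x‖²≈0 rows p)) (zeroˡ _)

    module Bounded (entries : EntriesIn[-1,1] B) where
      row-products : Fin n → Fin n → Fin n → Carrier
      row-products i k l = B i k * B i l

      s≈∑³ : s ≈ ∑³ row-products
      s≈∑³ = ∑-cong {n} (λ i → begin
        x 1 i * x 1 i                        ≈⟨ *-cong (row-sum≈x₁ i) (row-sum≈x₁ i) ⟨
        ∑ (λ k → B i k) * ∑ (λ l → B i l)    ≈⟨ ∑-*ʳ _ (B i) ⟨
        ∑ (λ k → B i k * ∑ (λ l → B i l))    ≈⟨ ∑-cong {n} (λ k → ∑-*ˡ (B i k) (B i)) ⟨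
        ∑ (λ k → ∑ (λ l → B i k * B i l))    ∎)

      -- The cyclic symmetrisation of a term is −(ab + bc + ca) with
      -- a = B_ik, b = B_kl, c = B_li, hence at most 1.
      cyclic : Fin n → Fin n → Fin n → Carrier
      cyclic i k l = row-products i k l + (row-products k l i + row-products l i k)

      cyclic≤1 : ∀ i k l → cyclic i k l ≼ 1#
      cyclic≤1 i k l = ≈-≤ cyclic≈ (cyclic-bound (proj₁ (entries i k)) (proj₂ (entries i k))
                                                 (proj₁ (entries k l)) (proj₂ (entries k l))
                                                 (proj₁ (entries l i)) (proj₂ (entries l i)))
        where
        cyclic≈ : cyclic i k l ≈ - (B i k * B k l + (B k l * B l i + B l i * B i k))
        cyclic≈ = trans (+-cong (*-congˡ (skew i l)) (+-cong (*-congˡ (skew k i)) (*-congˡ (skew l k))))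
                        (solve 3 (λ a b c → a :* (:- c) :+ (b :* (:- a) :+ c :* (:- b))
                                            := :- (a :* b :+ (b :* c :+ c :* a)))
                               refl (B i k) (B k l) (B l i))

      cube-bound : ⟦ + 3 ⟧ℤ * s ≼ N * (N * N)
      cube-bound = ≈-≤ 3s≈∑³cyclic (≤-≈ (∑³-mono cyclic (λ _ _ _ → 1#) cyclic≤1) (∑³-1 n))
        where
        3s≈∑³cyclic : ⟦ + 3 ⟧ℤ * s ≈ ∑³ cyclic
        3s≈∑³cyclic = begin
          ⟦ + 3 ⟧ℤ * s
            ≈⟨ solve 1 (λ s → K (+ 3) :* s := s :+ (s :+ s)) refl s ⟩
          s + (s + s)
            ≈⟨ +-cong s≈∑³ (+-cong (trans s≈∑³ (sym (∑³-rotate row-products)))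
                                   (trans s≈∑³ (sym (trans (∑³-rotate (λ i k l → row-products k l i))
                                                              (∑³-rotate row-products))))) ⟩
          ∑³ row-products + (∑³ (λ i k l → row-products k l i) + ∑³ (λ i k l → row-products l i k))
            ≈⟨ trans (∑³-+ row-products _) (+-congˡ (∑³-+ (λ i k l → row-products k l i) _)) ⟨
          ∑³ cyclic ∎

      trace⁸-bound : Tr (M ^ 8) ≼ X⁸ - w⁸ * s
      trace⁸-bound = 0≤y-x⇒x≤y (≤-≈ slack-nonneg (sym slack⁸))
        where
        slack-nonneg : 0# ≼ (⟦ + 2 ⟧ℤ * N) * ‖ z ‖² + ((⟦ + 4 ⟧ℤ * (N * N)) * s) * (N * (N * N) - ⟦ + 3 ⟧ℤ * s)
                             + (⟦ + 8 ⟧ℤ * s) * t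
        slack-nonneg =
          +-nonneg (+-nonneg (*-nonneg (*-nonneg (0≤numeral 2) (0≤fromℕ n)) (∑-nonneg {n} _ (λ i → square-nonneg (z i))))
                             (*-nonneg (*-nonneg (*-nonneg (0≤numeral 4) (square-nonneg N)) 0≤s) (x≤y⇒0≤y-x cube-bound)))
                   (*-nonneg (*-nonneg (0≤numeral 8) 0≤s) 0≤t)
          where
          0≤numeral : ∀ m → 0# ≼ ⟦ + m ⟧ℤ
          0≤numeral m = ≤-≈ (0≤fromℕ m) (fromℕ≈numeral m)

lemma17 : ∀ {c ℓ₁ ℓ₂} (R : RealField c ℓ₁ ℓ₂) →
            let open RealField R
                open Matrices R
            in ∀ (n : ℕ) (B : Matrix n) →
               SkewSymmetric B →
               EntriesIn[-1,1] B →
               (Tr ((J n ⊕ B) ^ 4) ≈ ((Tr (J n ^ 4) + Tr (B ^ 4)) - (fromℕ (4 ℕ.* n) * ‖ B · ones n ‖²)))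
               × ((Tr ((J n ⊕ B) ^ 8)) ≤ ((Tr (J n ^ 8) + Tr (B ^ 8)) - (fromℕ (2 ℕ.* (n ℕ.^ 5)) * ‖ B · ones n ‖²)))
               × ((Tr ((J n ⊕ B) ^ 4)) ≤ (Tr (J n ^ 4) + Tr (B ^ 4)))
               × ((Tr ((J n ⊕ B) ^ 8)) ≤ (Tr (J n ^ 8) + Tr (B ^ 8)))
               × ((Tr ((J n ⊕ B) ^ 4) ≈ (Tr (J n ^ 4) + Tr (B ^ 4))) ⇔ RowSumsZero B)
               × ((Tr ((J n ⊕ B) ^ 8) ≈ (Tr (J n ^ 8) + Tr (B ^ 8))) ⇔ RowSumsZero B)
lemma17 R n B skew entries =
    trace⁴
  , trace⁸-bound
  , drop-penalty (0≤fromℕ (4 ℕ.* n)) (O.reflexive trace⁴)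
  , drop-penalty (0≤fromℕ (2 ℕ.* (n ℕ.^ 5))) trace⁸-bound
  , mk⇔ (tight⇒row-sums-zero 1≤fromℕ[4n] (O.reflexive trace⁴)) row-sums-zero⇒trace⁴
  , mk⇔ (tight⇒row-sums-zero 1≤fromℕ[2n⁵] trace⁸-bound) row-sums-zero⇒trace⁸
  where
  open Theory R
  open Skew B skew
  open Bounded entries
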